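{- Let $\mathcal{A}$ and $\mathcal{B}$ be idempotent varieties of the same similarity type, and suppose there is a binary term $t$ in this type with $\mathcal{A}\models t(x,y)\approx x$ and $\mathcal{B}\models t(x,y)\approx t(y,x)$. Let $\mathbf{A}\in\mathcal{A}\circ\mathcal{B}$ and define $$\theta_{\mathbf{A}}=\{(a,b)\in A^2: t(a,b)=a\text{ and }t(b,a)=b\}.$$ Then $\theta_{\mathbf{A}}$ is a congruence of $\mathbf{A}$, and it is the unique congruence $\theta$ of $\mathbf{A}$ such that every $\theta$-class (as a subalgebra) lies in $\mathcal{A}$ and $\mathbf{A}/\theta\in\mathcal{B}$.
   Context: For idempotent varieties $\mathcal{A},\mathcal{B}$ of the same type, the Maltsev product $\mathcal{A}\circ\mathcal{B}$ is the class of all idempotent algebras $\mathbf{A}$ of that type having a congruence $\theta$ such that every $\theta$-class (as a subalgebra of $\mathbf{A}$) lies in $\mathcal{A}$ and $\mathbf{A}/\theta\in\mathcal{B}$; such a $\theta$ is said to witness $\mathbf{A}\in\mathcal{A}\circ\mathcal{B}$. -}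

module Defs where

open import Level using (0ℓ)
open import Data.Nat using (ℕ)
open import Data.Fin using (Fin; zero; suc)
open import Data.Product using (Σ; _×_; _,_; proj₁; proj₂)
open import Relation.Binary.Core using (Rel)
open import Relation.Binary.Structures using (IsEquivalence)
open import Relation.Binary.Bundles using (Setoid)

record Signature : Set₁ where
  field
    Op    : Set
    arity : Op → ℕ
open Signature public

data Term (σ : Signature) (X : Set) : Set where
  var  : X → Term σ X
  node : (f : Op σ) → (Fin (arity σ f) → Term σ X) → Term σ X

rename : {σ : Signature} {X Y : Set} → (X → Y) → Term σ X → Term σ Y
rename r (var x)     = var (r x)
rename r (node f ts) = node f (λ i → rename r (ts i))

-- Algebras of type σ, over a setoid (so that quotients can be formed).
record Algebra (σ : Signature) : Set₁ where
  field
    setoid : Setoid 0ℓ 0ℓ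
  open Setoid setoid public using (Carrier; _≈_)
  field
    op      : (f : Op σ) → (Fin (arity σ f) → Carrier) → Carrier
    op-cong : ∀ f {as bs : Fin (arity σ f) → Carrier} →
              (∀ i → as i ≈ bs i) → op f as ≈ op f bs
open Algebra public

module _ {σ : Signature} (𝐀 : Algebra σ) where
  private
    module S = Setoid (setoid 𝐀)

  eval : {X : Set} → Term σ X → (X → Carrier 𝐀) → Carrier 𝐀
  eval (var x)     ρ = ρ x
  eval (node f ts) ρ = op 𝐀 f (λ i → eval (ts i) ρ)

  _⊨_≈ₜ_ : {X : Set} → Term σ X → Term σ X → Set
  _⊨_≈ₜ_ s u = ∀ ρ → _≈_ 𝐀 (eval s ρ) (eval u ρ)

  Idempotent : Set
  Idempotent = ∀ f (a : Carrier 𝐀) → _≈_ 𝐀 (op 𝐀 f (λ _ → a)) a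

  record IsCongruence (θ : Rel (Carrier 𝐀) 0ℓ) : Set where
    field
      isEquivalence : IsEquivalence θ
      ≈⊆θ           : ∀ {a b} → _≈_ 𝐀 a b → θ a b
      compatible    : ∀ f {as bs : Fin (arity σ f) → Carrier 𝐀} →
                      (∀ i → θ (as i) (bs i)) → θ (op 𝐀 f as) (op 𝐀 f bs)

  Quotient : (θ : Rel (Carrier 𝐀) 0ℓ) → IsCongruence θ → Algebra σ
  Quotient θ c = record
    { setoid  = record { Carrier = Carrier 𝐀 ; _≈_ = θ
                       ; isEquivalence = IsCongruence.isEquivalence c }
    ; op      = op 𝐀
    ; op-cong = λ f → IsCongruence.compatible c f }

  -- the θ-class of a, as a subalgebra of 𝐀 (closed since 𝐀 is idempotent)
  Block : Idempotent → (θ : Rel (Carrier 𝐀) 0ℓ) → IsCongruence θ →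
          Carrier 𝐀 → Algebra σ
  Block idem θ c a = record
    { setoid  = record
        { Carrier = Σ (Carrier 𝐀) (θ a)
        ; _≈_ = λ x y → _≈_ 𝐀 (proj₁ x) (proj₁ y)
        ; isEquivalence = record
            { refl = S.refl ; sym = S.sym ; trans = S.trans } }
    ; op      = λ f bs → op 𝐀 f (λ i → proj₁ (bs i))
                       , E.trans (E.sym (IsCongruence.≈⊆θ c (idem f a)))
                                 (IsCongruence.compatible c f (λ i → proj₂ (bs i)))
    ; op-cong = λ f eq → op-cong 𝐀 f eq }
    where
      module E = IsEquivalence (IsCongruence.isEquivalence c)

-- A variety, given (Birkhoff) as the class of models of a set of identities.
record Variety (σ : Signature) : Set₁ where
  field
    identities : Term σ ℕ → Term σ ℕ → Set
open Variety public

_∈V_ : {σ : Signature} → Algebra σ → Variety σ → Set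
𝐀 ∈V V = ∀ s u → identities V s u → 𝐀 ⊨ s ≈ₜ u

_⊧_≈ᵥ_ : {σ : Signature} {X : Set} → Variety σ → Term σ X → Term σ X → Set₁
V ⊧ s ≈ᵥ u = ∀ 𝐀 → 𝐀 ∈V V → 𝐀 ⊨ s ≈ₜ u

IdempotentVariety : {σ : Signature} → Variety σ → Set₁
IdempotentVariety V = ∀ 𝐀 → 𝐀 ∈V V → Idempotent 𝐀

Witness : {σ : Signature} (𝒜 ℬ : Variety σ) (𝐀 : Algebra σ) →
          Idempotent 𝐀 → Rel (Carrier 𝐀) 0ℓ → Set
Witness 𝒜 ℬ 𝐀 idem θ =
  Σ (IsCongruence 𝐀 θ) λ c →
    (∀ a → Block 𝐀 idem θ c a ∈V 𝒜) × (Quotient 𝐀 θ c ∈V ℬ)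

_∈_∘_ : {σ : Signature} → Algebra σ → Variety σ → Variety σ → Set₁
𝐀 ∈ 𝒜 ∘ ℬ = Σ (Idempotent 𝐀) λ idem → Σ (Rel (Carrier 𝐀) 0ℓ) (Witness 𝒜 ℬ 𝐀 idem)

-- binary terms: variables x = zero, y = suc zero
swap₂ : Fin 2 → Fin 2
swap₂ zero       = suc zero
swap₂ (suc zero) = zero

app₂ : {σ : Signature} (𝐀 : Algebra σ) → Term σ (Fin 2) →
       Carrier 𝐀 → Carrier 𝐀 → Carrier 𝐀
app₂ 𝐀 t a b = eval 𝐀 t (λ { zero → a ; (suc zero) → b })

θ[_,_] : {σ : Signature} (𝐀 : Algebra σ) → Term σ (Fin 2) → Rel (Carrier 𝐀) 0ℓ
θ[ 𝐀 , t ] a b = _≈_ 𝐀 (app₂ 𝐀 t a b) a × _≈_ 𝐀 (app₂ 𝐀 t b a) b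

-- Let θ witness 𝐀 ∈ 𝒜 ∘ ℬ. If a θ b, then a and b lie in one block, an algebra of 𝒜, where
-- t is the first projection; so t(a,b) = a and t(b,a) = b. Conversely, if t(a,b) = a and
-- t(b,a) = b, then a = t(a,b) θ t(b,a) = b, since t is commutative in 𝐀/θ ∈ ℬ. Hence every
-- witness coincides with θ_𝐀, and the witnessing properties transfer to θ_𝐀 itself.
module Submission where

open import Defs
open import Data.Nat using (ℕ)
open import Data.Fin using (Fin; zero; suc)
open import Data.Product using (Σ; _×_; proj₁; proj₂; _,_)
open import Relation.Binary.Core using (Rel; _⇒_; _⇔_)
open import Relation.Binary.Structures using (IsEquivalence)
open import Relation.Binary.Bundles using (Setoid)
import Relation.Binary.Reasoning.Setoid as SetoidReasoning
open import Level using (0ℓ)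

module _ {σ : Signature} (𝐀 : Algebra σ) where
  private
    module S = Setoid (setoid 𝐀)

  eval-cong : ∀ {X} (s : Term σ X) {ρ ρ′ : X → Carrier 𝐀} →
              (∀ x → _≈_ 𝐀 (ρ x) (ρ′ x)) → _≈_ 𝐀 (eval 𝐀 s ρ) (eval 𝐀 s ρ′)
  eval-cong (var x)     ρ≈ρ′ = ρ≈ρ′ x
  eval-cong (node f ts) ρ≈ρ′ = op-cong 𝐀 f (λ i → eval-cong (ts i) ρ≈ρ′)

  eval-rename : ∀ {X Y} (r : X → Y) (s : Term σ X) (ρ : Y → Carrier 𝐀) →
                _≈_ 𝐀 (eval 𝐀 (rename r s) ρ) (eval 𝐀 s (λ x → ρ (r x)))
  eval-rename r (var x)     ρ = S.refl
  eval-rename r (node f ts) ρ = op-cong 𝐀 f (λ i → eval-rename r (ts i) ρ)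

  eval≈app₂ : (t : Term σ (Fin 2)) (ρ : Fin 2 → Carrier 𝐀) →
              _≈_ 𝐀 (eval 𝐀 t ρ) (app₂ 𝐀 t (ρ zero) (ρ (suc zero)))
  eval≈app₂ t ρ = eval-cong t λ { zero → S.refl ; (suc zero) → S.refl }

  eval-rename-swap₂ : (t : Term σ (Fin 2)) (ρ : Fin 2 → Carrier 𝐀) →
                      _≈_ 𝐀 (eval 𝐀 (rename swap₂ t) ρ) (app₂ 𝐀 t (ρ (suc zero)) (ρ zero))
  eval-rename-swap₂ t ρ = S.trans (eval-rename swap₂ t ρ) (eval≈app₂ t (λ x → ρ (swap₂ x)))

  IsCongruence-resp-⇔ : ∀ {θ θ′ : Rel (Carrier 𝐀) 0ℓ} →
                        θ ⇔ θ′ → IsCongruence 𝐀 θ → IsCongruence 𝐀 θ′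
  IsCongruence-resp-⇔ (θ⇒θ′ , θ′⇒θ) c = record
    { isEquivalence = record
        { refl  = θ⇒θ′ E.refl
        ; sym   = λ p → θ⇒θ′ (E.sym (θ′⇒θ p))
        ; trans = λ p q → θ⇒θ′ (E.trans (θ′⇒θ p) (θ′⇒θ q)) }
    ; ≈⊆θ        = λ a≈b → θ⇒θ′ (IsCongruence.≈⊆θ c a≈b)
    ; compatible = λ f ps → θ⇒θ′ (IsCongruence.compatible c f (λ i → θ′⇒θ (ps i))) }
    where
      module E = IsEquivalence (IsCongruence.isEquivalence c)

  module _ (θ : Rel (Carrier 𝐀) 0ℓ) (c : IsCongruence 𝐀 θ) where
    private
      ≈⇒θ : _≈_ 𝐀 ⇒ θ
      ≈⇒θ = IsCongruence.≈⊆θ c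

    eval-Quotient : ∀ {X} (s : Term σ X) (ρ : X → Carrier 𝐀) →
                    _≈_ 𝐀 (eval (Quotient 𝐀 θ c) s ρ) (eval 𝐀 s ρ)
    eval-Quotient (var x)     ρ = S.refl
    eval-Quotient (node f ts) ρ = op-cong 𝐀 f (λ i → eval-Quotient (ts i) ρ)

    Quotient-⊨⇒θ : ∀ {X} {s u : Term σ X} → Quotient 𝐀 θ c ⊨ s ≈ₜ u →
                   ∀ ρ → θ (eval 𝐀 s ρ) (eval 𝐀 u ρ)
    Quotient-⊨⇒θ {s = s} {u} Q⊨s≈u ρ = begin
      eval 𝐀 s ρ                 ≈⟨ ≈⇒θ (S.sym (eval-Quotient s ρ)) ⟩
      eval (Quotient 𝐀 θ c) s ρ  ≈⟨ Q⊨s≈u ρ ⟩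
      eval (Quotient 𝐀 θ c) u ρ  ≈⟨ ≈⇒θ (eval-Quotient u ρ) ⟩
      eval 𝐀 u ρ                 ∎
      where
        open SetoidReasoning (setoid (Quotient 𝐀 θ c))

    Quotient⊨t-comm⇒θ[t]⊆θ : (t : Term σ (Fin 2)) →
                             Quotient 𝐀 θ c ⊨ t ≈ₜ rename swap₂ t → θ[ 𝐀 , t ] ⇒ θ
    Quotient⊨t-comm⇒θ[t]⊆θ t Q⊨comm {a} {b} (tab≈a , tba≈b) = begin
      a                         ≈⟨ ≈⇒θ (S.sym tab≈a) ⟩
      app₂ 𝐀 t a b              ≈⟨ ≈⇒θ (S.sym (eval≈app₂ t ρ)) ⟩
      eval 𝐀 t ρ                ≈⟨ Quotient-⊨⇒θ {s = t} {rename swap₂ t} Q⊨comm ρ ⟩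
      eval 𝐀 (rename swap₂ t) ρ ≈⟨ ≈⇒θ (eval-rename-swap₂ t ρ) ⟩
      app₂ 𝐀 t b a              ≈⟨ ≈⇒θ tba≈b ⟩
      b                         ∎
      where
        open SetoidReasoning (setoid (Quotient 𝐀 θ c))
        ρ : Fin 2 → Carrier 𝐀
        ρ zero       = a
        ρ (suc zero) = b

  -- A quotient by a larger congruence is a homomorphic image.
  Quotient-⊨-mono : ∀ {θ θ′ : Rel (Carrier 𝐀) 0ℓ} (c : IsCongruence 𝐀 θ) (c′ : IsCongruence 𝐀 θ′) →
                    θ ⇒ θ′ → ∀ {X} {s u : Term σ X} →
                    Quotient 𝐀 θ c ⊨ s ≈ₜ u → Quotient 𝐀 θ′ c′ ⊨ s ≈ₜ u
  Quotient-⊨-mono {θ′ = θ′} c c′ θ⇒θ′ {s = s} {u} Q⊨s≈u ρ = begin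
    eval (Quotient 𝐀 θ′ c′) s ρ  ≈⟨ ≈⇒θ′ (eval-Quotient θ′ c′ s ρ) ⟩
    eval 𝐀 s ρ                   ≈⟨ θ⇒θ′ (Quotient-⊨⇒θ _ c {s = s} {u} Q⊨s≈u ρ) ⟩
    eval 𝐀 u ρ                   ≈⟨ ≈⇒θ′ (S.sym (eval-Quotient θ′ c′ u ρ)) ⟩
    eval (Quotient 𝐀 θ′ c′) u ρ  ∎
    where
      open SetoidReasoning (setoid (Quotient 𝐀 θ′ c′))
      ≈⇒θ′ : _≈_ 𝐀 ⇒ θ′
      ≈⇒θ′ = IsCongruence.≈⊆θ c′

  Quotient-∈V-mono : ∀ {θ θ′ : Rel (Carrier 𝐀) 0ℓ} (c : IsCongruence 𝐀 θ) (c′ : IsCongruence 𝐀 θ′) →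
                     θ ⇒ θ′ → (V : Variety σ) → Quotient 𝐀 θ c ∈V V → Quotient 𝐀 θ′ c′ ∈V V
  Quotient-∈V-mono c c′ θ⇒θ′ V Q∈V s u id = Quotient-⊨-mono c c′ θ⇒θ′ {s = s} {u} (Q∈V s u id)

  module _ (idem : Idempotent 𝐀) where

    eval-Block : ∀ θ c a {X} (s : Term σ X) (ρ : X → Carrier (Block 𝐀 idem θ c a)) →
                 _≈_ 𝐀 (proj₁ (eval (Block 𝐀 idem θ c a) s ρ)) (eval 𝐀 s (λ x → proj₁ (ρ x)))
    eval-Block θ c a (var x)     ρ = S.refl
    eval-Block θ c a (node f ts) ρ = op-cong 𝐀 f (λ i → eval-Block θ c a (ts i) ρ)

    -- A block of a smaller congruence is a subalgebra.
    Block-∈V-antimono : ∀ {θ θ′ : Rel (Carrier 𝐀) 0ℓ} (c : IsCongruence 𝐀 θ) (c′ : IsCongruence 𝐀 θ′) →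
                        θ′ ⇒ θ → (V : Variety σ) →
                        ∀ a → Block 𝐀 idem θ c a ∈V V → Block 𝐀 idem θ′ c′ a ∈V V
    Block-∈V-antimono {θ} {θ′} c c′ θ′⇒θ V a B∈V s u id ρ = begin
      proj₁ (eval (Block 𝐀 idem θ′ c′ a) s ρ)  ≈⟨ eval-Block θ′ c′ a s ρ ⟩
      eval 𝐀 s (λ x → proj₁ (ρ x))             ≈⟨ S.sym (eval-Block θ c a s ρ⁺) ⟩
      proj₁ (eval (Block 𝐀 idem θ c a) s ρ⁺)    ≈⟨ B∈V s u id ρ⁺ ⟩
      proj₁ (eval (Block 𝐀 idem θ c a) u ρ⁺)    ≈⟨ eval-Block θ c a u ρ⁺ ⟩
      eval 𝐀 u (λ x → proj₁ (ρ x))             ≈⟨ S.sym (eval-Block θ′ c′ a u ρ) ⟩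
      proj₁ (eval (Block 𝐀 idem θ′ c′ a) u ρ)  ∎
      where
        open SetoidReasoning (setoid 𝐀)
        ρ⁺ : ℕ → Carrier (Block 𝐀 idem θ c a)
        ρ⁺ x = proj₁ (ρ x) , θ′⇒θ (proj₂ (ρ x))

    Blocks⊨t≈x⇒θ⊆θ[t] : ∀ θ c (t : Term σ (Fin 2)) →
                        (∀ a → Block 𝐀 idem θ c a ⊨ t ≈ₜ var zero) → θ ⇒ θ[ 𝐀 , t ]
    Blocks⊨t≈x⇒θ⊆θ[t] θ c t B⊨t≈x {a} {b} aθb =
      t-in-block-of-a (a , E.refl) (b , aθb) , t-in-block-of-a (b , aθb) (a , E.refl)
      where
        module E = IsEquivalence (IsCongruence.isEquivalence c)
        t-in-block-of-a : (x y : Carrier (Block 𝐀 idem θ c a)) →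
                          _≈_ 𝐀 (app₂ 𝐀 t (proj₁ x) (proj₁ y)) (proj₁ x)
        t-in-block-of-a x y = S.trans (S.sym (eval≈app₂ t (λ i → proj₁ (ρ i))))
                                      (S.trans (S.sym (eval-Block θ c a t ρ)) (B⊨t≈x a ρ))
          where
            ρ : Fin 2 → Carrier (Block 𝐀 idem θ c a)
            ρ zero       = x
            ρ (suc zero) = y

lemma4p7 : (σ : Signature) (𝒜 ℬ : Variety σ) →
    IdempotentVariety 𝒜 → IdempotentVariety ℬ →
    (t : Term σ (Fin 2)) →
    𝒜 ⊧ t ≈ᵥ var zero →
    ℬ ⊧ t ≈ᵥ rename swap₂ t →
    (𝐀 : Algebra σ) (m : 𝐀 ∈ 𝒜 ∘ ℬ) →
    Σ (IsCongruence 𝐀 θ[ 𝐀 , t ]) (λ _ →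
      Witness 𝒜 ℬ 𝐀 (proj₁ m) θ[ 𝐀 , t ] ×
      ((θ : Rel (Carrier 𝐀) 0ℓ) → Witness 𝒜 ℬ 𝐀 (proj₁ m) θ →
        ∀ a b → (θ a b → θ[ 𝐀 , t ] a b) × (θ[ 𝐀 , t ] a b → θ a b)))
lemma4p7 σ 𝒜 ℬ _ _ t 𝒜⊧t≈x ℬ⊧t-comm 𝐀 (idem , θ₀ , w₀@(c₀ , blocks₀∈𝒜 , quotient₀∈ℬ)) =
  c , (c , blocks∈𝒜 , quotient∈ℬ) , λ θ w a b → proj₁ (witness⇔θ[t] θ w) , proj₂ (witness⇔θ[t] θ w)
  where
    witness⇔θ[t] : ∀ θ → Witness 𝒜 ℬ 𝐀 idem θ → θ ⇔ θ[ 𝐀 , t ]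
    witness⇔θ[t] θ (c , blocks∈𝒜 , quotient∈ℬ) =
      Blocks⊨t≈x⇒θ⊆θ[t] 𝐀 idem θ c t (λ a → 𝒜⊧t≈x (Block 𝐀 idem θ c a) (blocks∈𝒜 a)) ,
      Quotient⊨t-comm⇒θ[t]⊆θ 𝐀 θ c t (ℬ⊧t-comm (Quotient 𝐀 θ c) quotient∈ℬ)

    θ₀⇔θ[t] : θ₀ ⇔ θ[ 𝐀 , t ]
    θ₀⇔θ[t] = witness⇔θ[t] θ₀ w₀

    c : IsCongruence 𝐀 θ[ 𝐀 , t ]
    c = IsCongruence-resp-⇔ 𝐀 θ₀⇔θ[t] c₀

    blocks∈𝒜 : ∀ a → Block 𝐀 idem θ[ 𝐀 , t ] c a ∈V 𝒜
    blocks∈𝒜 a = Block-∈V-antimono 𝐀 idem c₀ c (proj₂ θ₀⇔θ[t]) 𝒜 a (blocks₀∈𝒜 a)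

    quotient∈ℬ : Quotient 𝐀 θ[ 𝐀 , t ] c ∈V ℬ
    quotient∈ℬ = Quotient-∈V-mono 𝐀 c₀ c (proj₁ θ₀⇔θ[t]) ℬ quotient₀∈ℬ
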